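{- For $n\ge 2$ and $2\le i\le n$, let $\mathrm{Top}(i;n)$ be the number of permutations $\sigma\in S_n$ (in one-line notation $\sigma(1)\cdots\sigma(n)$) such that $i$ is a descent top, i.e. $i=\sigma(p)$ for some $p\le n-1$ with $\sigma(p+1)<i$; for $2\le i<j\le n$ let $\mathrm{Top}(i,j;n)$ be the number of $\sigma\in S_n$ having both $i$ and $j$ as descent tops. Then $\mathrm{Top}(i;n)\,\mathrm{Top}(j;n)\ge n!\,\mathrm{Top}(i,j;n)$ for all $2\le i<j\le n$. -}

module Defs where

open import Data.Nat using (ℕ; zero; suc; _<_; _<ᵇ_; _≡ᵇ_; _*_)
open import Data.Bool using (Bool; true; false; _∧_; _∨_)
open import Data.List using (List; []; _∷_; map; concatMap; length; filterᵇ; upTo)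

insertions : ℕ → List ℕ → List (List ℕ)
insertions x []       = (x ∷ []) ∷ []
insertions x (y ∷ ys) = (x ∷ y ∷ ys) ∷ map (y ∷_) (insertions x ys)

perms : List ℕ → List (List ℕ)
perms []       = [] ∷ []
perms (x ∷ xs) = concatMap (insertions x) (perms xs)

oneTo : ℕ → List ℕ
oneTo n = map suc (upTo n)

Sₙ : ℕ → List (List ℕ)
Sₙ n = perms (oneTo n)

isDescentTop : ℕ → List ℕ → Bool
isDescentTop i []           = false
isDescentTop i (a ∷ [])     = false
isDescentTop i (a ∷ b ∷ ws) = ((a ≡ᵇ i) ∧ (b <ᵇ i)) ∨ isDescentTop i (b ∷ ws)

Top₁ : ℕ → ℕ → ℕ
Top₁ i n = length (filterᵇ (isDescentTop i) (Sₙ n))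

Top₂ : ℕ → ℕ → ℕ → ℕ
Top₂ i j n = length (filterᵇ (λ σ → isDescentTop i σ ∧ isDescentTop j σ) (Sₙ n))

module Submission where

-- Proof idea.  Both counts are computed exactly:
--
--   Top(i;n) = (i-1)·(n-1)!        Top(i,j;n) = (i-1)·(j-2)·(n-2)!
--
-- after which the inequality reduces to n·(j-2) ≤ (j-1)·(n-1), i.e. j ≤ n+1.
--
-- The permutations of [a+1,…,a+m] are built by inserting the least letter
-- x = a+1 in every position of every permutation τ of [a+2,…,a+m].  The key
-- observation (the insertion lemma) is that for a letter i > x, inserting x
-- right behind the letter p of τ (or at the front, read as "behind a sentinel
-- letter 0") makes i a descent top iff i already is one in τ or p = i.  So τ
-- contributes all its insertions when i is a descent top of τ and exactly one
-- otherwise, and similarly for two letters i ≠ j.  This yields first-order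
-- recurrences which are solved by induction along the segment [a+1,…,a+m].

open import Defs
open import Data.Nat using (ℕ; _≤_; _<_; _*_; _!)
open import Data.Nat using (zero; suc; _+_; _≡ᵇ_; _<ᵇ_; z≤n; s≤s; z<s)
open import Data.Nat.Properties
  using ( ≡ᵇ⇒≡; ≡⇒≡ᵇ; <ᵇ⇒<; <⇒<ᵇ; <⇒≢; ≤⇒≯; ≤-refl; ≤-reflexive; ≤-trans; n≤1+n
        ; m<m+n; +-monoʳ-<; +-mono-≤; +-comm; +-suc; +-commutativeSemigroup
        ; *-comm; *-suc; *-zeroʳ; *-identityʳ; *-distribˡ-+; *-monoʳ-≤; module ≤-Reasoning)
open import Data.Nat.ListAction using (sum)
open import Data.Nat.ListAction.Properties using (sum-++; sum-↭)
open import Data.Nat.Tactic.RingSolver using (solve-∀)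
open import Algebra.Properties.CommutativeSemigroup +-commutativeSemigroup using (interchange)
open import Data.Bool using (Bool; true; false; _∧_; _∨_; if_then_else_)
open import Data.Bool.Properties using (T-≡; ∨-assoc; ∨-identityʳ; ∨-zeroʳ; ∧-identityʳ; ∧-zeroʳ)
open import Data.List using (List; []; _∷_; map; length; filterᵇ; concatMap; _++_; applyUpTo)
open import Data.List.Properties using (map-++; map-∘; map-cong; length-map; ∷-injective)
open import Data.List.Relation.Unary.All as All using (All; []; _∷_)
open import Data.List.Relation.Unary.All.Properties using (concat⁺) renaming (map⁺ to All-map⁺)
open import Data.List.Relation.Binary.Permutation.Propositional
  using (_↭_; prep; swap; ↭-refl; ↭-sym; ↭-trans)
open import Data.List.Relation.Binary.Permutation.Propositional.Properties
  using (↭-length; All-resp-↭; map⁺)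
open import Data.Product using (_,_)
open import Function using (_∘_; Equivalence)
open import Relation.Binary.PropositionalEquality
  using (_≡_; _≢_; refl; sym; trans; cong; cong₂; subst₂; module ≡-Reasoning)
open import Relation.Nullary using (contradiction)

≡ᵇ-false : ∀ {m n} → m ≢ n → (m ≡ᵇ n) ≡ false
≡ᵇ-false {m} {n} m≢n with m ≡ᵇ n in eq
... | false = refl
... | true  = contradiction (≡ᵇ⇒≡ m n (Equivalence.from T-≡ eq)) m≢n

≡ᵇ-refl : ∀ n → (n ≡ᵇ n) ≡ true
≡ᵇ-refl n = Equivalence.to T-≡ (≡⇒≡ᵇ n n refl)

<ᵇ-true : ∀ {m n} → m < n → (m <ᵇ n) ≡ true
<ᵇ-true m<n = Equivalence.to T-≡ (<⇒<ᵇ m<n)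

<ᵇ-false : ∀ {m n} → n ≤ m → (m <ᵇ n) ≡ false
<ᵇ-false {m} {n} n≤m with m <ᵇ n in eq
... | false = refl
... | true  = contradiction (<ᵇ⇒< m n (Equivalence.from T-≡ eq)) (≤⇒≯ n≤m)

≡ᵇ-both : ∀ {i j} → i ≢ j → ∀ p → ((p ≡ᵇ i) ∧ (p ≡ᵇ j)) ≡ false
≡ᵇ-both {i} {j} i≢j p with p ≡ᵇ i in eq
... | false = refl
... | true  = ≡ᵇ-false (λ p≡j → i≢j (trans (sym (≡ᵇ⇒≡ p i (Equivalence.from T-≡ eq))) p≡j))

𝟙 : Bool → ℕ
𝟙 b = if b then 1 else 0

∑ : {A : Set} → (A → ℕ) → List A → ℕ
∑ f xs = sum (map f xs)

count : {A : Set} → (A → Bool) → List A → ℕ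
count P = ∑ (𝟙 ∘ P)

length-filterᵇ : {A : Set} (P : A → Bool) (xs : List A) → length (filterᵇ P xs) ≡ count P xs
length-filterᵇ P []       = refl
length-filterᵇ P (x ∷ xs) with P x
... | true  = cong suc (length-filterᵇ P xs)
... | false = length-filterᵇ P xs

∑-one : {A : Set} (xs : List A) → ∑ (λ _ → 1) xs ≡ length xs
∑-one []       = refl
∑-one (x ∷ xs) = cong suc (∑-one xs)

∑-const : {A : Set} (k : ℕ) (xs : List A) → ∑ (λ _ → k) xs ≡ k * length xs
∑-const k []       = sym (*-zeroʳ k)
∑-const k (x ∷ xs) = trans (cong (k +_) (∑-const k xs)) (sym (*-suc k (length xs)))

∑-+ : {A : Set} (f g : A → ℕ) (xs : List A) → ∑ (λ x → f x + g x) xs ≡ ∑ f xs + ∑ g xs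
∑-+ f g []       = refl
∑-+ f g (x ∷ xs) =
  trans (cong (f x + g x +_) (∑-+ f g xs)) (interchange (f x) (g x) (∑ f xs) (∑ g xs))

∑-* : {A : Set} (k : ℕ) (f : A → ℕ) (xs : List A) → ∑ (λ x → k * f x) xs ≡ k * ∑ f xs
∑-* k f []       = sym (*-zeroʳ k)
∑-* k f (x ∷ xs) = trans (cong (k * f x +_) (∑-* k f xs)) (sym (*-distribˡ-+ k (f x) (∑ f xs)))

∑-cong : {A : Set} {f g : A → ℕ} {xs : List A} → All (λ x → f x ≡ g x) xs → ∑ f xs ≡ ∑ g xs
∑-cong []       = refl
∑-cong (e ∷ es) = cong₂ _+_ e (∑-cong es)

∑-concatMap : {A B : Set} (f : B → ℕ) (g : A → List B) (ls : List A) →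
  ∑ f (concatMap g ls) ≡ ∑ (∑ f ∘ g) ls
∑-concatMap f g []       = refl
∑-concatMap f g (l ∷ ls) = begin
  sum (map f (g l ++ concatMap g ls))          ≡⟨ cong sum (map-++ f (g l) (concatMap g ls)) ⟩
  sum (map f (g l) ++ map f (concatMap g ls))  ≡⟨ sum-++ (map f (g l)) (map f (concatMap g ls)) ⟩
  ∑ f (g l) + ∑ f (concatMap g ls)             ≡⟨ cong (∑ f (g l) +_) (∑-concatMap f g ls) ⟩
  ∑ f (g l) + ∑ (∑ f ∘ g) ls                   ∎
  where open ≡-Reasoning

count-via-map : {A B : Set} {P : A → Bool} {Q : B → Bool} {xs : List A} {ys : List B} →
  map P xs ≡ map Q ys → count P xs ≡ count Q ys
count-via-map {xs = xs} {ys} e =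
  trans (cong sum (map-∘ xs)) (trans (cong (sum ∘ map 𝟙) e) (sym (cong sum (map-∘ ys))))

count-cong : {A : Set} {P Q : A → Bool} → (∀ x → P x ≡ Q x) → (xs : List A) → count P xs ≡ count Q xs
count-cong e xs = cong sum (map-cong (cong 𝟙 ∘ e) xs)

count-none : {A : Set} {P : A → Bool} {xs : List A} → All (λ x → P x ≡ false) xs → count P xs ≡ 0
count-none []                 = refl
count-none (Px≡false ∷ rest) rewrite Px≡false = count-none rest

count-↭ : {A : Set} (P : A → Bool) {xs ys : List A} → xs ↭ ys → count P xs ≡ count P ys
count-↭ P xs↭ys = sum-↭ (map⁺ (𝟙 ∘ P) xs↭ys)

-- Permutations as iterated insertions

insertions-↭ : ∀ x τ → All (_↭ x ∷ τ) (insertions x τ)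
insertions-↭ x []       = ↭-refl ∷ []
insertions-↭ x (y ∷ ys) = ↭-refl ∷ All-map⁺
  (All.map (λ w↭ → ↭-trans (prep y w↭) (swap y x ↭-refl)) (insertions-↭ x ys))

perms-↭ : ∀ L → All (_↭ L) (perms L)
perms-↭ []       = ↭-refl ∷ []
perms-↭ (x ∷ xs) = concat⁺ (All-map⁺ (All.map
  (λ {τ} τ↭xs → All.map (λ w↭ → ↭-trans w↭ (prep x τ↭xs)) (insertions-↭ x τ))
  (perms-↭ xs)))

length-insertions : ∀ x τ → length (insertions x τ) ≡ suc (length τ)
length-insertions x []       = refl
length-insertions x (y ∷ ys) =
  cong suc (trans (length-map (y ∷_) (insertions x ys)) (length-insertions x ys))

length-perms : ∀ L → length (perms L) ≡ length L !
length-perms []       = refl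
length-perms (x ∷ xs) = begin
  length (concatMap (insertions x) (perms xs))      ≡⟨ ∑-one (concatMap (insertions x) (perms xs)) ⟨
  ∑ (λ _ → 1) (concatMap (insertions x) (perms xs)) ≡⟨ ∑-concatMap (λ _ → 1) (insertions x) (perms xs) ⟩
  ∑ (∑ (λ _ → 1) ∘ insertions x) (perms xs)         ≡⟨ ∑-cong (All.map each (perms-↭ xs)) ⟩
  ∑ (λ _ → suc (length xs)) (perms xs)               ≡⟨ ∑-const (suc (length xs)) (perms xs) ⟩
  suc (length xs) * length (perms xs)                ≡⟨ cong (suc (length xs) *_) (length-perms xs) ⟩
  suc (length xs) !                                  ∎
  where
  open ≡-Reasoning
  each : ∀ {τ} → τ ↭ xs → ∑ (λ _ → 1) (insertions x τ) ≡ suc (length xs)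
  each {τ} τ↭xs =
    trans (∑-one (insertions x τ)) (trans (length-insertions x τ) (cong suc (↭-length τ↭xs)))

no-descent-top : ∀ {i} w → All (i ≤_) w → isDescentTop i w ≡ false
no-descent-top []          _                 = refl
no-descent-top (a ∷ [])    _                 = refl
no-descent-top {i} (a ∷ b ∷ w) (_ ∷ i≤b ∷ i≤w) = cong₂ _∨_
  (trans (cong ((a ≡ᵇ i) ∧_) (<ᵇ-false i≤b)) (∧-zeroʳ (a ≡ᵇ i)))
  (no-descent-top (b ∷ w) (i≤b ∷ i≤w))

least-letter-no-top : ∀ {i} L → All (i ≤_) L → All (λ τ → isDescentTop i τ ≡ false) (perms L)
least-letter-no-top L i≤L =
  All.map (λ τ↭L → no-descent-top _ (All-resp-↭ (↭-sym τ↭L) i≤L)) (perms-↭ L)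

-- The insertion lemma

sentinel : ∀ {i} → 0 < i → ∀ w → isDescentTop i (0 ∷ w) ≡ isDescentTop i w
sentinel z<s []      = refl
sentinel z<s (b ∷ w) = refl

∨-absorb : ∀ Y Z D → Y ∨ D ≡ ((Y ∧ Z) ∨ D) ∨ Y
∨-absorb true  Z D = sym (∨-zeroʳ (Z ∨ D))
∨-absorb false Z D = sym (∨-identityʳ D)

module _ {x i : ℕ} (x<i : x < i) where

  insert-behind : ∀ y τ → map (λ w → isDescentTop i (y ∷ w)) (insertions x τ)
                        ≡ map (λ p → isDescentTop i (y ∷ τ) ∨ (p ≡ᵇ i)) (y ∷ τ)
  insert-behind y [] rewrite <ᵇ-true x<i = cong (_∷ []) (trans (∨-identityʳ _) (∧-identityʳ (y ≡ᵇ i)))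
  insert-behind y (z ∷ zs) = cong₂ _∷_ directly-behind-y further-on
    where
    Y A D : Bool
    Y = y ≡ᵇ i
    A = Y ∧ (z <ᵇ i)
    D = isDescentTop i (z ∷ zs)
    directly-behind-y : (Y ∧ (x <ᵇ i)) ∨ (((x ≡ᵇ i) ∧ (z <ᵇ i)) ∨ D) ≡ (A ∨ D) ∨ Y
    directly-behind-y rewrite <ᵇ-true x<i | ≡ᵇ-false (<⇒≢ x<i) =
      trans (cong (_∨ D) (∧-identityʳ Y)) (∨-absorb Y (z <ᵇ i) D)
    open ≡-Reasoning
    further-on : map (λ w → isDescentTop i (y ∷ w)) (map (z ∷_) (insertions x zs))
               ≡ map (λ p → (A ∨ D) ∨ (p ≡ᵇ i)) (z ∷ zs)
    further-on = begin
      map (λ w → isDescentTop i (y ∷ w)) (map (z ∷_) (insertions x zs)) ≡⟨ map-∘ (insertions x zs) ⟨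
      map ((A ∨_) ∘ (λ w → isDescentTop i (z ∷ w))) (insertions x zs)    ≡⟨ map-∘ (insertions x zs) ⟩
      map (A ∨_) (map (λ w → isDescentTop i (z ∷ w)) (insertions x zs))  ≡⟨ cong (map (A ∨_)) (insert-behind z zs) ⟩
      map (A ∨_) (map (λ p → D ∨ (p ≡ᵇ i)) (z ∷ zs))                   ≡⟨ map-∘ (z ∷ zs) ⟨
      map (λ p → A ∨ (D ∨ (p ≡ᵇ i))) (z ∷ zs)                          ≡⟨ map-cong (λ p → sym (∨-assoc A D (p ≡ᵇ i))) (z ∷ zs) ⟩
      map (λ p → (A ∨ D) ∨ (p ≡ᵇ i)) (z ∷ zs)                          ∎

  -- The insertion lemma: the insertions of x into τ correspond to the
  -- positions 0 ∷ τ (front, or behind the letter p), and the one behind p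
  -- has i as a descent top iff τ does or p = i.
  insertion-lemma : ∀ τ → map (isDescentTop i) (insertions x τ)
               ≡ map (λ p → isDescentTop i τ ∨ (p ≡ᵇ i)) (0 ∷ τ)
  insertion-lemma τ = begin
    map (isDescentTop i) (insertions x τ)            ≡⟨ map-cong (sym ∘ sentinel 0<i) (insertions x τ) ⟩
    map (λ w → isDescentTop i (0 ∷ w)) (insertions x τ) ≡⟨ insert-behind 0 τ ⟩
    map (λ p → isDescentTop i (0 ∷ τ) ∨ (p ≡ᵇ i)) (0 ∷ τ)
      ≡⟨ map-cong (λ p → cong (_∨ (p ≡ᵇ i)) (sentinel 0<i τ)) (0 ∷ τ) ⟩
    map (λ p → isDescentTop i τ ∨ (p ≡ᵇ i)) (0 ∷ τ)  ∎
    where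
    open ≡-Reasoning
    0<i : 0 < i
    0<i = ≤-trans (s≤s z≤n) x<i

map-combine : {A B C : Set} (h : Bool → Bool → C) {f g : A → Bool} {f′ g′ : B → Bool} →
  ∀ {xs ys} → map f xs ≡ map f′ ys → map g xs ≡ map g′ ys →
  map (λ w → h (f w) (g w)) xs ≡ map (λ p → h (f′ p) (g′ p)) ys
map-combine h {xs = []}     {[]}     _  _  = refl
map-combine h {xs = x ∷ xs} {y ∷ ys} e₁ e₂
  with fx≡ , fs≡ ← ∷-injective e₁ | gx≡ , gs≡ ← ∷-injective e₂ =
  cong₂ _∷_ (cong₂ h fx≡ gx≡) (map-combine h fs≡ gs≡)

positions-single : ∀ {i} → 0 < i → ∀ b τ → count (_≡ᵇ i) τ ≡ 1 →
  count (λ p → b ∨ (p ≡ᵇ i)) (0 ∷ τ) ≡ 1 + length τ * 𝟙 b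
positions-single z<s true  τ _    = cong suc (trans (∑-one τ) (sym (*-identityʳ (length τ))))
positions-single z<s false τ once = trans once (cong suc (sym (*-zeroʳ (length τ))))

positions-pair : ∀ {i j} → 0 < i → 0 < j → i ≢ j → ∀ bi bj τ {k} → length τ ≡ suc k →
  count (_≡ᵇ i) τ ≡ 1 → count (_≡ᵇ j) τ ≡ 1 →
  count (λ p → (bi ∨ (p ≡ᵇ i)) ∧ (bj ∨ (p ≡ᵇ j))) (0 ∷ τ) ≡ 𝟙 bi + 𝟙 bj + k * 𝟙 (bi ∧ bj)
positions-pair z<s z<s _ true  true  τ {k} len _ _ =
  cong suc (trans (∑-one τ) (trans len (cong suc (sym (*-identityʳ k)))))
positions-pair z<s z<s _ true  false τ {k} _ _ oncej = trans oncej (cong suc (sym (*-zeroʳ k)))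
positions-pair {i} z<s z<s _ false true τ {k} _ oncei _ =
  trans (count-cong (λ p → ∧-identityʳ (p ≡ᵇ i)) (0 ∷ τ)) (trans oncei (cong suc (sym (*-zeroʳ k))))
positions-pair z<s z<s i≢j false false τ {k} _ _ _ =
  trans (count-cong (≡ᵇ-both i≢j) (0 ∷ τ)) (trans (∑-const 0 (0 ∷ τ)) (sym (*-zeroʳ k)))

-- The recurrences

bothTops : ℕ → ℕ → List ℕ → Bool
bothTops i j w = isDescentTop i w ∧ isDescentTop j w

topStep : ∀ {x i} xs → x < i → count (_≡ᵇ i) xs ≡ 1 →
  count (isDescentTop i) (perms (x ∷ xs))
    ≡ length xs ! + length xs * count (isDescentTop i) (perms xs)
topStep {x} {i} xs x<i once = begin
  ∑ (𝟙 ∘ isDescentTop i) (concatMap (insertions x) (perms xs))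
    ≡⟨ ∑-concatMap (𝟙 ∘ isDescentTop i) (insertions x) (perms xs) ⟩
  ∑ (count (isDescentTop i) ∘ insertions x) (perms xs)
    ≡⟨ ∑-cong (All.map contribution (perms-↭ xs)) ⟩
  ∑ (λ τ → 1 + m * 𝟙 (isDescentTop i τ)) (perms xs)
    ≡⟨ ∑-+ (λ _ → 1) (λ τ → m * 𝟙 (isDescentTop i τ)) (perms xs) ⟩
  ∑ (λ _ → 1) (perms xs) + ∑ (λ τ → m * 𝟙 (isDescentTop i τ)) (perms xs)
    ≡⟨ cong₂ _+_ (trans (∑-one (perms xs)) (length-perms xs)) (∑-* m (𝟙 ∘ isDescentTop i) (perms xs)) ⟩
  m ! + m * count (isDescentTop i) (perms xs) ∎
  where
  open ≡-Reasoning
  m : ℕ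
  m = length xs
  contribution : ∀ {τ} → τ ↭ xs → count (isDescentTop i) (insertions x τ) ≡ 1 + m * 𝟙 (isDescentTop i τ)
  contribution {τ} τ↭xs = begin
    count (isDescentTop i) (insertions x τ)          ≡⟨ count-via-map {ys = 0 ∷ τ} (insertion-lemma x<i τ) ⟩
    count (λ p → isDescentTop i τ ∨ (p ≡ᵇ i)) (0 ∷ τ)
      ≡⟨ positions-single (≤-trans (s≤s z≤n) x<i) (isDescentTop i τ) τ (trans (count-↭ (_≡ᵇ i) τ↭xs) once) ⟩
    1 + length τ * 𝟙 (isDescentTop i τ)              ≡⟨ cong (λ ℓ → 1 + ℓ * 𝟙 (isDescentTop i τ)) (↭-length τ↭xs) ⟩
    1 + m * 𝟙 (isDescentTop i τ)                     ∎

pairStep : ∀ {x i j} xs {k} → x < i → x < j → i ≢ j → length xs ≡ suc k →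
  count (_≡ᵇ i) xs ≡ 1 → count (_≡ᵇ j) xs ≡ 1 →
  count (bothTops i j) (perms (x ∷ xs))
    ≡ count (isDescentTop i) (perms xs) + count (isDescentTop j) (perms xs)
      + k * count (bothTops i j) (perms xs)
pairStep {x} {i} {j} xs {k} x<i x<j i≢j len oncei oncej = begin
  ∑ (𝟙 ∘ bothTops i j) (concatMap (insertions x) (perms xs))
    ≡⟨ ∑-concatMap (𝟙 ∘ bothTops i j) (insertions x) (perms xs) ⟩
  ∑ (count (bothTops i j) ∘ insertions x) (perms xs)
    ≡⟨ ∑-cong (All.map contribution (perms-↭ xs)) ⟩
  ∑ (λ τ → (Ti τ + Tj τ) + k * 𝟙 (bothTops i j τ)) (perms xs)
    ≡⟨ ∑-+ (λ τ → Ti τ + Tj τ) (λ τ → k * 𝟙 (bothTops i j τ)) (perms xs) ⟩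
  ∑ (λ τ → Ti τ + Tj τ) (perms xs) + ∑ (λ τ → k * 𝟙 (bothTops i j τ)) (perms xs)
    ≡⟨ cong₂ _+_ (∑-+ Ti Tj (perms xs)) (∑-* k (𝟙 ∘ bothTops i j) (perms xs)) ⟩
  count (isDescentTop i) (perms xs) + count (isDescentTop j) (perms xs)
    + k * count (bothTops i j) (perms xs) ∎
  where
  open ≡-Reasoning
  Ti Tj : List ℕ → ℕ
  Ti = 𝟙 ∘ isDescentTop i
  Tj = 𝟙 ∘ isDescentTop j
  contribution : ∀ {τ} → τ ↭ xs →
    count (bothTops i j) (insertions x τ) ≡ (Ti τ + Tj τ) + k * 𝟙 (bothTops i j τ)
  contribution {τ} τ↭xs = trans
    (count-via-map {ys = 0 ∷ τ} (map-combine _∧_ {ys = 0 ∷ τ} (insertion-lemma x<i τ) (insertion-lemma x<j τ)))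
    (positions-pair (≤-trans (s≤s z≤n) x<i) (≤-trans (s≤s z≤n) x<j) i≢j
      (isDescentTop i τ) (isDescentTop j τ) τ (trans (↭-length τ↭xs) len)
      (trans (count-↭ (_≡ᵇ i) τ↭xs) oncei) (trans (count-↭ (_≡ᵇ j) τ↭xs) oncej))

-- Segments and the closed formulas

-- seg a m = [a+1, …, a+m]; the letter a + suc r sits at position r.
seg : ℕ → ℕ → List ℕ
seg a zero    = []
seg a (suc m) = suc a ∷ seg (suc a) m

oneTo-seg : ∀ n → oneTo n ≡ seg 0 n
oneTo-seg n = go (λ k → k) 0 n (λ k → refl)
  where
  go : ∀ f a m → (∀ k → f k ≡ a + k) → map suc (applyUpTo f m) ≡ seg a m
  go f a zero    f≗a+ = refl
  go f a (suc m) f≗a+ = cong₂ _∷_ (cong suc (trans (f≗a+ 0) (+-comm a 0)))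
    (go (f ∘ suc) (suc a) m (λ k → trans (f≗a+ (suc k)) (+-suc a k)))

length-seg : ∀ a m → length (seg a m) ≡ m
length-seg a zero    = refl
length-seg a (suc m) = cong suc (length-seg (suc a) m)

seg-above : ∀ a m → All (suc a ≤_) (seg a m)
seg-above a zero    = []
seg-above a (suc m) = ≤-refl ∷ All.map (≤-trans (n≤1+n (suc a))) (seg-above (suc a) m)

-- Re-indexing the position r + 1 of seg a as position r of seg (suc a).
shift : ∀ {i} a r → i ≡ a + suc (suc r) → i ≡ suc a + suc r
shift a r e = trans e (+-suc a (suc r))

above-start : ∀ {i} a r → i ≡ a + suc r → a < i
above-start a r refl = m<m+n a z<s

seg-occurrence : ∀ a m r {i} → i ≡ a + suc r → r < m → count (_≡ᵇ i) (seg a m) ≡ 1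
seg-occurrence a (suc m) zero {i} e _ rewrite trans e (+-comm a 1) | ≡ᵇ-refl a =
  cong suc (count-none (All.map (λ a+1<p → ≡ᵇ-false (<⇒≢ a+1<p ∘ sym)) (seg-above (suc a) m)))
seg-occurrence a (suc m) (suc r) e (s≤s r<m)
  rewrite ≡ᵇ-false (<⇒≢ (above-start (suc a) r (shift a r e))) = seg-occurrence (suc a) m r (shift a r e) r<m

topCount : ∀ a m r {i} → i ≡ a + suc r → r ≤ m →
  count (isDescentTop i) (perms (seg a (suc m))) ≡ r * m !
topCount a m zero e _ = count-none (least-letter-no-top (seg a (suc m))
  (All.map (≤-trans (≤-reflexive (trans e (+-comm a 1)))) (seg-above a (suc m))))
topCount a (suc m) (suc r) {i} e (s≤s r≤m) = begin
  count (isDescentTop i) (perms (suc a ∷ xs))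
    ≡⟨ topStep xs (above-start (suc a) r e′) (seg-occurrence (suc a) (suc m) r e′ (s≤s r≤m)) ⟩
  length xs ! + length xs * count (isDescentTop i) (perms xs)
    ≡⟨ cong₂ (λ ℓ c → ℓ ! + ℓ * c) (length-seg (suc a) (suc m)) (topCount (suc a) m r e′ r≤m) ⟩
  suc m ! + suc m * (r * m !)
    ≡⟨ recurrence m r (m !) ⟩
  suc r * suc m ! ∎
  where
  open ≡-Reasoning
  xs : List ℕ
  xs = seg (suc a) (suc m)
  e′ : i ≡ suc a + suc r
  e′ = shift a r e
  recurrence : ∀ m r f → suc m * f + suc m * (r * f) ≡ suc r * (suc m * f)
  recurrence = solve-∀

pairCount : ∀ a m r s {i j} → i ≡ a + suc r → j ≡ a + suc (suc s) → r ≤ s → s ≤ m →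
  count (bothTops i j) (perms (seg a (suc (suc m)))) ≡ r * s * m !
pairCount a m zero s ei _ _ _ = count-none (All.map (cong (_∧ _))
  (least-letter-no-top (seg a (suc (suc m)))
    (All.map (≤-trans (≤-reflexive (trans ei (+-comm a 1)))) (seg-above a (suc (suc m))))))
pairCount a (suc m) (suc r) (suc s) {i} {j} ei ej (s≤s r≤s) (s≤s s≤m) = begin
  count (bothTops i j) (perms (suc a ∷ xs))
    ≡⟨ pairStep xs (above-start (suc a) r ei′) (above-start (suc a) (suc s) ej′) i≢j
         (length-seg (suc a) (suc (suc m)))
         (seg-occurrence (suc a) _ r ei′ (s≤s r≤1+m))
         (seg-occurrence (suc a) _ (suc s) ej′ (s≤s (s≤s s≤m))) ⟩
  count (isDescentTop i) (perms xs) + count (isDescentTop j) (perms xs)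
    + suc m * count (bothTops i j) (perms xs)
    ≡⟨ cong₂ _+_ (cong₂ _+_ (topCount (suc a) (suc m) r ei′ r≤1+m)
                            (topCount (suc a) (suc m) (suc s) ej′ (s≤s s≤m)))
                 (cong (suc m *_) (pairCount (suc a) m r s ei′ ej′ r≤s s≤m)) ⟩
  r * suc m ! + suc s * suc m ! + suc m * (r * s * m !)
    ≡⟨ recurrence m r s (m !) ⟩
  suc r * suc s * suc m ! ∎
  where
  open ≡-Reasoning
  xs : List ℕ
  xs = seg (suc a) (suc (suc m))
  ei′ : i ≡ suc a + suc r
  ei′ = shift a r ei
  ej′ : j ≡ suc a + suc (suc s)
  ej′ = shift a (suc s) ej
  r≤1+m : r ≤ suc m
  r≤1+m = ≤-trans r≤s (≤-trans s≤m (n≤1+n m))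
  i≢j : i ≢ j
  i≢j = <⇒≢ (subst₂ _<_ (sym ei) (sym ej) (+-monoʳ-< a (s≤s (s≤s (s≤s r≤s)))))
  recurrence : ∀ m r s f →
    r * (suc m * f) + suc s * (suc m * f) + suc m * (r * s * f) ≡ suc r * suc s * (suc m * f)
  recurrence = solve-∀

Top₁-formula : ∀ m r → r ≤ m → Top₁ (suc r) (suc m) ≡ r * m !
Top₁-formula m r r≤m = begin
  length (filterᵇ (isDescentTop (suc r)) (perms (oneTo (suc m))))
    ≡⟨ length-filterᵇ (isDescentTop (suc r)) (perms (oneTo (suc m))) ⟩
  count (isDescentTop (suc r)) (perms (oneTo (suc m)))
    ≡⟨ cong (count (isDescentTop (suc r)) ∘ perms) (oneTo-seg (suc m)) ⟩
  count (isDescentTop (suc r)) (perms (seg 0 (suc m)))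
    ≡⟨ topCount 0 m r refl r≤m ⟩
  r * m ! ∎
  where open ≡-Reasoning

Top₂-formula : ∀ m r s → r ≤ s → s ≤ m → Top₂ (suc r) (suc (suc s)) (suc (suc m)) ≡ r * s * m !
Top₂-formula m r s r≤s s≤m = begin
  length (filterᵇ (bothTops (suc r) (suc (suc s))) (perms (oneTo (suc (suc m)))))
    ≡⟨ length-filterᵇ (bothTops (suc r) (suc (suc s))) (perms (oneTo (suc (suc m)))) ⟩
  count (bothTops (suc r) (suc (suc s))) (perms (oneTo (suc (suc m))))
    ≡⟨ cong (count (bothTops (suc r) (suc (suc s))) ∘ perms) (oneTo-seg (suc (suc m))) ⟩
  count (bothTops (suc r) (suc (suc s))) (perms (seg 0 (suc (suc m))))
    ≡⟨ pairCount 0 m r s refl refl r≤s s≤m ⟩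
  r * s * m ! ∎
  where open ≡-Reasoning

-- With the closed formulas, the theorem is (N+2)·s ≤ (s+1)·(N+1) in disguise.
factorial-inequality : ∀ N r s → s ≤ suc N →
  suc (suc N) ! * (r * s * N !) ≤ (r * suc N !) * (suc s * suc N !)
factorial-inequality N r s s≤1+N = begin
  suc (suc N) ! * (r * s * N !)           ≡⟨ regroup-left N r s (N !) ⟩
  c * (suc (suc N) * s)                   ≤⟨ *-monoʳ-≤ c (+-mono-≤ s≤1+N (≤-reflexive (*-comm (suc N) s))) ⟩
  c * (suc s * suc N)                     ≡⟨ regroup-right N r s (N !) ⟨
  (r * suc N !) * (suc s * suc N !)       ∎
  where
  open ≤-Reasoning
  c : ℕ
  c = r * suc N * N ! * N !
  regroup-left : ∀ N r s f → (suc (suc N) * (suc N * f)) * (r * s * f) ≡ (r * suc N * f * f) * (suc (suc N) * s)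
  regroup-left = solve-∀
  regroup-right : ∀ N r s f → (r * (suc N * f)) * (suc s * (suc N * f)) ≡ (r * suc N * f * f) * (suc s * suc N)
  regroup-right = solve-∀

mainTheorem15 : (n i j : ℕ) → 2 ≤ n → 2 ≤ i → i < j → j ≤ n →
    (n !) * Top₂ i j n ≤ Top₁ i n * Top₁ j n
mainTheorem15 (suc (suc N)) (suc r) (suc (suc s)) _ _ (s≤s (s≤s r≤s)) (s≤s (s≤s s≤N)) = begin
  suc (suc N) ! * Top₂ (suc r) (suc (suc s)) (suc (suc N))
    ≡⟨ cong (suc (suc N) ! *_) (Top₂-formula N r s r≤s s≤N) ⟩
  suc (suc N) ! * (r * s * N !)
    ≤⟨ factorial-inequality N r s (≤-trans s≤N (n≤1+n N)) ⟩
  (r * suc N !) * (suc s * suc N !)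
    ≡⟨ cong₂ _*_ (Top₁-formula (suc N) r (≤-trans r≤s (≤-trans s≤N (n≤1+n N))))
                 (Top₁-formula (suc N) (suc s) (s≤s s≤N)) ⟨
  Top₁ (suc r) (suc (suc N)) * Top₁ (suc (suc s)) (suc (suc N)) ∎
  where open ≤-Reasoning
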